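{- Let $I$ be a stable matching instance of size $n$ with $\mathrm{range}(I)\le k$, and let $i \in [n]$ be an integer. Then there are at most $50 k^2$ rotations $\rho$ of $I$ such that $i \in \mathrm{ext}(\rho)$.
   Context: For a stable matching instance $I$ with complete preferences ($n$ men, $n$ women), $\min\mathrm{rank}(a)$ and $\max\mathrm{rank}(a)$ are the minimum and maximum rank agent $a$ receives from agents of the opposite sex, and $\mathrm{range}(I)=\max_a(\max\mathrm{rank}(a)-\min\mathrm{rank}(a))+1$. For a rotation $\rho=(m_0,w_0),\ldots,(m_{\ell-1},w_{\ell-1})$ of $I$ with $\mathrm{range}(I)\le k$, let $r_{\min}(\rho)$ and $r_{\max}(\rho)$ be the minimum and maximum of $\min\mathrm{rank}(a)$ over all agents $a$ in $\rho$; the extent of $\rho$ is the integer interval $\mathrm{ext}(\rho)=[r_{\min}(\rho)-2k+1,\ r_{\max}(\rho)+2k-1]$. -}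

module Defs where

open import Data.Nat as ℕ using (ℕ; zero; suc; _+_; _*_; _∸_; _<_; _≤_; _⊓_; _⊔_)
open import Data.Fin using (Fin; toℕ) renaming (zero to fzero; suc to fsuc)
open import Data.Integer as ℤ using (ℤ; +_)
open import Data.List using (List; []; _∷_; map; foldr; concatMap; length)
open import Data.List.Membership.Propositional using (_∈_)
open import Data.List.Relation.Unary.All using (All)
open import Data.List.Relation.Unary.Unique.Propositional using (Unique)
open import Data.Product using (_×_; _,_; proj₁; proj₂; ∃)
open import Function using (_∘_)
open import Function.Definitions using (Injective)
open import Relation.Binary.PropositionalEquality using (_≡_; _≢_)
open import Relation.Nullary using (¬_)

-- Men and women are both indexed by Fin n.
-- mpos m w = (0-based) position of woman w in man m's list; a permutation.
-- wpos w m = (0-based) position of man m in woman w's list; a permutation.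
record Instance (n : ℕ) : Set where
  field
    mpos : Fin n → Fin n → Fin n
    wpos : Fin n → Fin n → Fin n
    mpos-inj : ∀ m → Injective _≡_ _≡_ (mpos m)
    wpos-inj : ∀ w → Injective _≡_ _≡_ (wpos w)

module _ {n : ℕ} (I : Instance n) where
  open Instance I

  -- 1-based ranks: mrank m w = rank man m gives to woman w
  mrank : Fin n → Fin n → ℕ
  mrank m w = suc (toℕ (mpos m w))

  wrank : Fin n → Fin n → ℕ
  wrank w m = suc (toℕ (wpos w m))

-- minimum / maximum of a function over Fin n (value 0 for n = 0)
minF : ∀ {n} → (Fin n → ℕ) → ℕ
minF {zero} f = 0
minF {suc zero} f = f fzero
minF {suc (suc n)} f = f fzero ⊓ minF (f ∘ fsuc)

maxF : ∀ {n} → (Fin n → ℕ) → ℕ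
maxF {zero} f = 0
maxF {suc n} f = f fzero ⊔ maxF (f ∘ fsuc)

-- minimum / maximum of a list (listMin [] = 0, only used on nonempty lists)
listMin : List ℕ → ℕ
listMin [] = 0
listMin (x ∷ xs) = foldr _⊓_ x xs

listMax : List ℕ → ℕ
listMax = foldr _⊔_ 0

module _ {n : ℕ} (I : Instance n) where

  minrankM maxrankM : Fin n → ℕ
  minrankM m = minF (λ w → wrank I w m)
  maxrankM m = maxF (λ w → wrank I w m)

  minrankW maxrankW : Fin n → ℕ
  minrankW w = minF (λ m → mrank I m w)
  maxrankW w = maxF (λ m → mrank I m w)

  range : ℕ
  range = maxF (λ m → maxrankM m ∸ minrankM m + 1)
        ⊔ maxF (λ w → maxrankW w ∸ minrankW w + 1)

  -- A (perfect) matching: man m is matched to woman M m; M injective.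
  IsMatching : (Fin n → Fin n) → Set
  IsMatching M = Injective _≡_ _≡_ M

  PrefersToPartner : (Fin n → Fin n) → Fin n → Fin n → Set
  PrefersToPartner M w m = ∀ m' → M m' ≡ w → wrank I w m < wrank I w m'

  IsStable : (Fin n → Fin n) → Set
  IsStable M = IsMatching M ×
    (∀ m w → ¬ (mrank I m w < mrank I m (M m) × PrefersToPartner M w m))

  IsNext : (Fin n → Fin n) → Fin n → Fin n → Set
  IsNext M m w = mrank I m (M m) < mrank I m w × PrefersToPartner M w m ×
    (∀ w' → mrank I m (M m) < mrank I m w' → mrank I m w' < mrank I m w →
       ¬ PrefersToPartner M w' m)

cycPairs : ∀ {A : Set} → List A → List (A × A)
cycPairs {A} [] = []
cycPairs {A} (x ∷ xs) = go (x ∷ xs)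
  where
  go : List A → List (A × A)
  go [] = []
  go (a ∷ []) = (a , x) ∷ []
  go (a ∷ b ∷ r) = (a , b) ∷ go (b ∷ r)

module _ {n : ℕ} (I : Instance n) where

  IsRotationIn : (Fin n → Fin n) → List (Fin n × Fin n) → Set
  IsRotationIn M ρ = ρ ≢ [] × Unique (map proj₁ ρ) ×
    All (λ p → M (proj₁ p) ≡ proj₂ p) ρ ×
    All (λ q → IsNext I M (proj₁ (proj₁ q)) (proj₂ (proj₂ q))) (cycPairs ρ)

  IsRotation : List (Fin n × Fin n) → Set
  IsRotation ρ = ∃ λ M → IsStable I M × IsRotationIn M ρ

  agentMinranks : List (Fin n × Fin n) → List ℕ
  agentMinranks ρ = concatMap (λ p → minrankM I (proj₁ p) ∷ minrankW I (proj₂ p) ∷ []) ρ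

  rmin rmax : List (Fin n × Fin n) → ℕ
  rmin ρ = listMin (agentMinranks ρ)
  rmax ρ = listMax (agentMinranks ρ)

  InExt : ℕ → List (Fin n × Fin n) → ℕ → Set
  InExt k ρ i =
    (+ rmin ρ ℤ.- + (2 * k) ℤ.+ + 1) ℤ.≤ + i ×
    + i ℤ.≤ (+ rmax ρ ℤ.+ + (2 * k) ℤ.- + 1)

-- two rotations are the same iff they consist of the same pairs
SamePairs : ∀ {n} → List (Fin n × Fin n) → List (Fin n × Fin n) → Set
SamePairs ρ σ = ∀ p → (p ∈ ρ → p ∈ σ) × (p ∈ σ → p ∈ ρ)

-- Two rotations sharing a pair coincide: both survive in the men-worst meet of the stable matchings
-- exposing them, where the successor map s determines a rotation from any one of its pairs.
-- In a stable matching every man m has |mrank m (M m) − minrank m| ≤ 2k and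
-- minrank m ≤ minrank (M m) + 2k, by counting the women m ranks above his partner (and dually).
-- If i ∈ ext ρ, some agent of ρ has minrank ≤ i + 2k and some has minrank ≥ i − 2k, so some man of
-- ρ has minrank below i + 4k and some above i − 4k; as the minranks of consecutive men of ρ drop by
-- less than k, some man m of ρ has minrank within 4k of i. His pair (m , w) in ρ is determined by
-- wrank w₀ m, confined to a window of width 9k, and mrank m w, confined to one of width 4k + 1, so
-- there are at most 9k (4k + 1) ≤ 50k² such rotations.

module Submission where

open import Defs
open import Data.Nat using (ℕ; zero; suc; _+_; _*_; _∸_; _<_; _≤_; _≤?_; _⊓_; z≤n; s≤s; s≤s⁻¹; z<s)
open import Data.Nat.Properties hiding (_≟_)
open import Data.Nat.GeneralisedArithmetic using (fold; fold-+)
open import Data.Nat.Tactic.RingSolver using (solve-∀)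
open import Data.Integer as ℤ using (+_)
import Data.Integer.Properties as ℤ
import Data.Integer.Tactic.RingSolver as ℤ
open import Data.Fin using (Fin; toℕ; fromℕ<; inject≤; punchOut; combine) renaming (zero to fzero; suc to fsuc)
open import Data.Fin.Properties
  using (any?; _≟_; pigeonhole; injective⇒≤; toℕ<n; toℕ-inject≤; inject≤-injective; punchOut-injective;
         toℕ-injective; toℕ-fromℕ<; combine-injectiveˡ; combine-injectiveʳ)
open import Data.List using (List; []; _∷_; drop; foldr; length)
open import Data.List.Membership.Propositional using (_∈_; find; lose)
open import Data.List.Relation.Unary.Any as Any using (here; there)
open import Data.List.Relation.Unary.All as All using (All; []; _∷_)
open import Data.List.Relation.Unary.AllPairs using (AllPairs; []; _∷_)
open import Data.Product using (∃; _×_; _,_; proj₁; proj₂)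
open import Data.Sum using (_⊎_; inj₁; inj₂; [_,_])
open import Data.Empty using (⊥-elim)
open import Function using (_∘_; _∘′_)
open import Function.Definitions using (Injective)
open import Relation.Binary.Construct.Closure.ReflexiveTransitive using (Star; ε; _◅_; _◅◅_)
import Relation.Binary.Construct.Closure.ReflexiveTransitive as Star
open import Relation.Binary.Definitions using (tri<; tri≈; tri>)
open import Relation.Binary.PropositionalEquality hiding ([_])
open import Relation.Nullary using (¬_; yes; no)
open import Relation.Nullary.Decidable using (_×-dec_)

-- Injections and counting on Fin n

injective⇒surjective : ∀ {n} {f : Fin n → Fin n} → Injective _≡_ _≡_ f → ∀ y → ∃ λ x → f x ≡ y
injective⇒surjective {suc n} {f} f-inj y with any? (λ x → f x ≟ y)
... | yes found = found
... | no missed = ⊥-elim (<-irrefl refl (injective⇒≤ punchOut-f-injective))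
  where
  y≢f : ∀ x → y ≢ f x
  y≢f x eq = missed (x , sym eq)
  punchOut-f-injective : Injective _≡_ _≡_ (λ x → punchOut (y≢f x))
  punchOut-f-injective eq = f-inj (punchOut-injective (y≢f _) (y≢f _) eq)

module _ {n : ℕ} {f : Fin n → Fin n} (f-inj : Injective _≡_ _≡_ f) where

  preimage : Fin n → Fin n
  preimage y = proj₁ (injective⇒surjective f-inj y)

  f∘preimage : ∀ y → f (preimage y) ≡ y
  f∘preimage y = proj₂ (injective⇒surjective f-inj y)

  preimage-injective : Injective _≡_ _≡_ preimage
  preimage-injective {y} {y'} eq =
    trans (sym (f∘preimage y)) (trans (cong f eq) (f∘preimage y'))

  fold-injective : ∀ t {x y} → fold x f t ≡ fold y f t → x ≡ y
  fold-injective zero eq = eq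
  fold-injective (suc t) eq = fold-injective t (f-inj eq)

  orbit-returns : ∀ x → ∃ λ t → fold x f (suc t) ≡ x
  orbit-returns x with pigeonhole (n<1+n n) (λ j → fold x f (toℕ j))
  ... | i , j , i<j , eq = d , sym (fold-injective (toℕ i) (begin
        fold x f (toℕ i)                  ≡⟨ eq ⟩
        fold x f (toℕ j)                  ≡⟨ cong (fold x f) (sym i+suc-d≡j) ⟩
        fold x f (toℕ i + suc d)          ≡⟨ fold-+ x f (toℕ i) ⟩
        fold (fold x f (suc d)) f (toℕ i) ∎))
    where
    open ≡-Reasoning
    d : ℕ
    d = toℕ j ∸ suc (toℕ i)
    i+suc-d≡j : toℕ i + suc d ≡ toℕ j
    i+suc-d≡j = trans (+-suc (toℕ i) d) (m+[n∸m]≡n i<j)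

  -- The orbit of f x returns to f x, and by injectivity the point just before that return is x.
  invariant⇒co-invariant : (P : Fin n → Set) → (∀ x → P x → P (f x)) → ∀ x → P (f x) → P x
  invariant⇒co-invariant P step x Pfx with orbit-returns (f x)
  ... | t , returns = subst P (f-inj returns) (along t)
    where
    along : ∀ s → P (fold (f x) f s)
    along zero = Pfx
    along (suc s) = step _ (along s)

offset : ∀ {lo x len} → lo ≤ x → x < lo + len → Fin len
offset {lo} {x} {len} lo≤x x<lo+len =
  fromℕ< (subst (x ∸ lo <_) (m+n∸m≡n lo len) (∸-monoˡ-< x<lo+len lo≤x))

offset-injective : ∀ {lo x y len} (lo≤x : lo ≤ x) (x< : x < lo + len) (lo≤y : lo ≤ y) (y< : y < lo + len) →
  offset lo≤x x< ≡ offset lo≤y y< → x ≡ y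
offset-injective lo≤x x< lo≤y y< eq =
  ∸-cancelʳ-≡ lo≤x lo≤y (trans (sym (toℕ-fromℕ< _)) (trans (cong toℕ eq) (toℕ-fromℕ< _)))

bounded-injection⇒≤ : ∀ {a n c} {f : Fin a → Fin n} → Injective _≡_ _≡_ f → (∀ j → toℕ (f j) < c) → a ≤ c
bounded-injection⇒≤ {f = f} f-inj bounded = injective⇒≤ λ {i} {j} eq →
  f-inj (toℕ-injective (trans (sym (toℕ-fromℕ< (bounded i))) (trans (cong toℕ eq) (toℕ-fromℕ< (bounded j)))))

prefix-count : ∀ {n} {pos f : Fin n → Fin n} → Injective _≡_ _≡_ pos → Injective _≡_ _≡_ f →
  ∀ x c → (∀ y → toℕ (pos y) ≤ toℕ (pos x) → toℕ (f y) < c) → toℕ (pos x) < c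
prefix-count {n} {pos} {f} pos-inj f-inj x c bounded =
  bounded-injection⇒≤ {f = f ∘ atPosition} (atPosition-injective ∘ f-inj) λ j → bounded _ (atPosition-≤ j)
  where
  atPosition : Fin (suc (toℕ (pos x))) → Fin n
  atPosition j = preimage pos-inj (inject≤ j (toℕ<n (pos x)))
  atPosition-injective : Injective _≡_ _≡_ atPosition
  atPosition-injective eq = inject≤-injective _ _ _ _ (preimage-injective pos-inj eq)
  atPosition-≤ : ∀ j → toℕ (pos (atPosition j)) ≤ toℕ (pos x)
  atPosition-≤ j rewrite f∘preimage pos-inj (inject≤ j (toℕ<n (pos x))) | toℕ-inject≤ j (toℕ<n (pos x)) =
    s≤s⁻¹ (toℕ<n j)

module _ {A : Set} {P : A → Set} {R : A → A → Set} {c : ℕ} (code : ∀ {x} → P x → Fin c)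
  (separates : ∀ {x y} (px : P x) (py : P y) → R x y → code px ≢ code py) where

  private
    codes : ∀ {xs} → All P xs → Fin (length xs) → Fin c
    codes (px ∷ _) fzero = code px
    codes (_ ∷ ps) (fsuc j) = codes ps j

    code∉codes : ∀ {x xs} (px : P x) (ps : All P xs) → All (R x) xs → ∀ j → code px ≢ codes ps j
    code∉codes px (py ∷ _) (r ∷ _) fzero = separates px py r
    code∉codes px (_ ∷ ps) (_ ∷ rs) (fsuc j) = code∉codes px ps rs j

    codes-injective : ∀ {xs} (ps : All P xs) → AllPairs R xs → Injective _≡_ _≡_ (codes ps)
    codes-injective (_ ∷ _) (_ ∷ _) {fzero} {fzero} _ = refl
    codes-injective (px ∷ ps) (rs ∷ _) {fzero} {fsuc j} eq = ⊥-elim (code∉codes px ps rs j eq)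
    codes-injective (px ∷ ps) (rs ∷ _) {fsuc i} {fzero} eq = ⊥-elim (code∉codes px ps rs i (sym eq))
    codes-injective (_ ∷ ps) (_ ∷ distinct) {fsuc i} {fsuc j} eq = cong fsuc (codes-injective ps distinct eq)

  length≤-by-separating-code : ∀ {xs} → All P xs → AllPairs R xs → length xs ≤ c
  length≤-by-separating-code ps distinct = injective⇒≤ (codes-injective ps distinct)

-- Cyclic lists

Star-preserves : ∀ {A : Set} {R : A → A → Set} (P : A → Set) → (∀ {x y} → R x y → P x → P y) →
  ∀ {x y} → Star R x y → P x → P y
Star-preserves P step = Star.fold (λ x y → P x → P y) (λ r k → k ∘′ step r) (λ px → px)

module _ {A : Set} where

  -- A nameable copy of the local function go of cycPairs, which closes the cycle back to x.
  linksTo : A → List A → List (A × A)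
  linksTo x [] = []
  linksTo x (a ∷ []) = (a , x) ∷ []
  linksTo x (a ∷ b ∷ r) = (a , b) ∷ linksTo x (b ∷ r)

  private
    linksTo-tail : ∀ x a r → linksTo x (a ∷ r) ≡ drop 1 (cycPairs (x ∷ a ∷ r))
    linksTo-tail x a [] = refl
    linksTo-tail x a (b ∷ r) = cong ((a , b) ∷_) (linksTo-tail x b r)

    cycPairs≡linksTo : ∀ x l → cycPairs (x ∷ l) ≡ linksTo x (x ∷ l)
    cycPairs≡linksTo x [] = refl
    cycPairs≡linksTo x (a ∷ r) = cong ((x , a) ∷_) (sym (linksTo-tail x a r))

  Link : List (A × A) → A → A → Set
  Link ps p q = (p , q) ∈ ps

  private
    linksTo-from-head : ∀ x a r {e} → e ∈ a ∷ r → Star (Link (linksTo x (a ∷ r))) a e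
    linksTo-from-head x a r (here refl) = ε
    linksTo-from-head x a (b ∷ r) (there e∈) = here refl ◅ Star.map there (linksTo-from-head x b r e∈)

    linksTo-to-end : ∀ x a r {e} → e ∈ a ∷ r → Star (Link (linksTo x (a ∷ r))) e x
    linksTo-to-end x a [] (here refl) = here refl ◅ ε
    linksTo-to-end x a (b ∷ r) (here refl) = here refl ◅ Star.map there (linksTo-to-end x b r (here refl))
    linksTo-to-end x a (b ∷ r) (there e∈) = Star.map there (linksTo-to-end x b r e∈)

    linksTo-successor : ∀ x a r {e} → e ∈ a ∷ r → ∃ λ q → (e , q) ∈ linksTo x (a ∷ r)
    linksTo-successor x a [] (here refl) = x , here refl
    linksTo-successor x a (b ∷ r) (here refl) = b , here refl
    linksTo-successor x a (b ∷ r) (there e∈) with q , link ← linksTo-successor x b r e∈ = q , there link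

    linksTo-members : ∀ x a r {p q} → (p , q) ∈ linksTo x (a ∷ r) → p ∈ a ∷ r × (q ∈ a ∷ r ⊎ q ≡ x)
    linksTo-members x a [] (here refl) = here refl , inj₂ refl
    linksTo-members x a (b ∷ r) (here refl) = here refl , inj₁ (there (here refl))
    linksTo-members x a (b ∷ r) (there link) with linksTo-members x b r link
    ... | p∈ , inj₁ q∈ = there p∈ , inj₁ (there q∈)
    ... | p∈ , inj₂ q≡x = there p∈ , inj₂ q≡x

  cycPairs-connected : ∀ xs {p q} → p ∈ xs → q ∈ xs → Star (Link (cycPairs xs)) p q
  cycPairs-connected (x ∷ l) p∈ q∈ rewrite cycPairs≡linksTo x l =
    linksTo-to-end x x l p∈ ◅◅ linksTo-from-head x x l q∈

  cycPairs-successor : ∀ xs {p} → p ∈ xs → ∃ λ q → (p , q) ∈ cycPairs xs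
  cycPairs-successor (x ∷ l) p∈ rewrite cycPairs≡linksTo x l = linksTo-successor x x l p∈

  cycPairs-members : ∀ xs {p q} → (p , q) ∈ cycPairs xs → p ∈ xs × q ∈ xs
  cycPairs-members (x ∷ l) link rewrite cycPairs≡linksTo x l with linksTo-members x x l link
  ... | p∈ , inj₁ q∈ = p∈ , q∈
  ... | p∈ , inj₂ refl = p∈ , here refl

  cycPairs-transport : ∀ xs (P : A → Set) → (∀ {p q} → (p , q) ∈ cycPairs xs → P p → P q) →
    ∀ {p q} → p ∈ xs → q ∈ xs → P p → P q
  cycPairs-transport xs P step p∈ q∈ = Star-preserves P step (cycPairs-connected xs p∈ q∈)

  cycles-of-functional-relation : (S : A → A → Set) → (∀ {p q q'} → S p q → S p q' → q ≡ q') →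
    ∀ ρ σ → (∀ {p q} → (p , q) ∈ cycPairs ρ → S p q) → (∀ {p q} → (p , q) ∈ cycPairs σ → S p q) →
    ∀ {e} → e ∈ ρ → e ∈ σ → ∀ {p} → p ∈ ρ → p ∈ σ
  cycles-of-functional-relation S functional ρ σ ρ-steps σ-steps e∈ρ e∈σ p∈ρ =
    cycPairs-transport ρ (_∈ σ) step e∈ρ p∈ρ e∈σ
    where
    step : ∀ {a b} → (a , b) ∈ cycPairs ρ → a ∈ σ → b ∈ σ
    step link a∈σ with b' , link' ← cycPairs-successor σ a∈σ
      rewrite functional (ρ-steps link) (σ-steps link') = proj₂ (cycPairs-members σ link')

-- Stable matchings, their men-worst meet, and rotations

module _ {n : ℕ} (I : Instance n) where
  open Instance I

  mrank-injective : ∀ m → Injective _≡_ _≡_ (mrank I m)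
  mrank-injective m eq = mpos-inj m (toℕ-injective (suc-injective eq))

  wrank-injective : ∀ w → Injective _≡_ _≡_ (wrank I w)
  wrank-injective w eq = wpos-inj w (toℕ-injective (suc-injective eq))

  prefersToPartner : ∀ {M} → IsMatching I M → ∀ {w x y} → M y ≡ w → wrank I w x < wrank I w y →
    PrefersToPartner I M w x
  prefersToPartner M-inj My≡w lt m' Mm'≡w rewrite M-inj (trans My≡w (sym Mm'≡w)) = lt

  module _ {M : Fin n → Fin n} (stable : IsStable I M) where
    private
      M-inj : IsMatching I M
      M-inj = proj₁ stable
      unblocked : ∀ m w → ¬ (mrank I m w < mrank I m (M m) × PrefersToPartner I M w m)
      unblocked = proj₂ stable

    woman-prefers-partner : ∀ {x y w} → mrank I x w < mrank I x (M x) → M y ≡ w → wrank I w y < wrank I w x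
    woman-prefers-partner {x} {y} {w} x-prefers My≡w = ≤∧≢⇒< (≮⇒≥ not-blocking) y≢x
      where
      not-blocking : ¬ (wrank I w x < wrank I w y)
      not-blocking w-prefers = unblocked x w (x-prefers , prefersToPartner M-inj My≡w w-prefers)
      y≢x : wrank I w y ≢ wrank I w x
      y≢x eq with refl ← wrank-injective w eq = <-irrefl (cong (mrank I x) (sym My≡w)) x-prefers

    man-prefers-partner : ∀ {y z w} → M z ≡ w → wrank I w y < wrank I w z → mrank I y (M y) < mrank I y w
    man-prefers-partner {y} {z} {w} Mz≡w w-prefers = ≤∧≢⇒< (≮⇒≥ not-blocking) My≢w
      where
      not-blocking : ¬ (mrank I y w < mrank I y (M y))
      not-blocking y-prefers = unblocked y w (y-prefers , prefersToPartner M-inj Mz≡w w-prefers)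
      My≢w : mrank I y (M y) ≢ mrank I y w
      My≢w eq with refl ← M-inj (trans (mrank-injective y eq) (sym Mz≡w)) = <-irrefl refl w-prefers

    woman-weakly-prefers-partner : ∀ {x y w} → mrank I x w ≤ mrank I x (M x) → M y ≡ w →
      wrank I w y ≤ wrank I w x
    woman-weakly-prefers-partner {x} x-weakly-prefers My≡w with m≤n⇒m<n∨m≡n x-weakly-prefers
    ... | inj₁ x-prefers = <⇒≤ (woman-prefers-partner x-prefers My≡w)
    ... | inj₂ eq with refl ← M-inj (trans My≡w (mrank-injective x eq)) = ≤-refl

    man-weakly-prefers-partner : ∀ {y z w} → M z ≡ w → wrank I w y ≤ wrank I w z →
      mrank I y (M y) ≤ mrank I y w
    man-weakly-prefers-partner {y} Mz≡w w-weakly-prefers with m≤n⇒m<n∨m≡n w-weakly-prefers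
    ... | inj₁ w-prefers = <⇒≤ (man-prefers-partner Mz≡w w-prefers)
    ... | inj₂ eq with refl ← wrank-injective _ eq = ≤-reflexive (cong (mrank I y) Mz≡w)

  -- The injection x ↦ M'⁻¹ (M x) maps men who prefer M to M' to such men; were y one of them,
  -- so would be its preimage a.
  men-gain⇒women-lose : ∀ {M M'} → IsStable I M → IsStable I M' → ∀ {a y} →
    mrank I a (M' a) < mrank I a (M a) → M' y ≡ M a → wrank I (M a) a < wrank I (M a) y
  men-gain⇒women-lose {M} {M'} stable stable' {a} {y} a-gains M'y≡Ma = ≤∧≢⇒< (≮⇒≥ y-not-preferred) a≢y
    where
    M-inj : IsMatching I M
    M-inj = proj₁ stable
    M'-inj : IsMatching I M'
    M'-inj = proj₁ stable'
    PrefersM : Fin n → Set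
    PrefersM x = mrank I x (M x) < mrank I x (M' x)
    next : Fin n → Fin n
    next x = preimage M'-inj (M x)
    next-injective : Injective _≡_ _≡_ next
    next-injective eq = M-inj (trans (sym (f∘preimage M'-inj _)) (trans (cong M' eq) (f∘preimage M'-inj _)))
    next-preserves : ∀ x → PrefersM x → PrefersM (next x)
    next-preserves x x-prefers = subst (λ w → mrank I (next x) (M (next x)) < mrank I (next x) w)
      (sym (f∘preimage M'-inj (M x)))
      (man-prefers-partner stable refl (woman-prefers-partner stable' x-prefers (f∘preimage M'-inj (M x))))
    next-a≡y : next a ≡ y
    next-a≡y = M'-inj (trans (f∘preimage M'-inj (M a)) (sym M'y≡Ma))
    y-not-preferred : ¬ (wrank I (M a) y < wrank I (M a) a)
    y-not-preferred Ma-prefers-y = <-asym a-gains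
      (invariant⇒co-invariant next-injective PrefersM next-preserves a (subst PrefersM (sym next-a≡y) y-prefers))
      where
      y-prefers : PrefersM y
      y-prefers = subst (λ w → mrank I y (M y) < mrank I y w) (sym M'y≡Ma) (man-prefers-partner stable refl Ma-prefers-y)
    a≢y : wrank I (M a) a ≢ wrank I (M a) y
    a≢y eq with refl ← wrank-injective (M a) eq = <-irrefl (cong (mrank I a) M'y≡Ma) a-gains

  MenWorstOf : (M M' N : Fin n → Fin n) → Set
  MenWorstOf M M' N = ∀ x →
    (N x ≡ M x × mrank I x (M' x) ≤ mrank I x (M x)) ⊎ (N x ≡ M' x × mrank I x (M x) ≤ mrank I x (M' x))

  MenWorstOf-sym : ∀ {M M' N} → MenWorstOf M M' N → MenWorstOf M' M N
  MenWorstOf-sym worst x with worst x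
  ... | inj₁ fromM = inj₂ fromM
  ... | inj₂ fromM' = inj₁ fromM'

  menWorst : (M M' : Fin n → Fin n) → Fin n → Fin n
  menWorst M M' x with mrank I x (M x) ≤? mrank I x (M' x)
  ... | yes _ = M' x
  ... | no _ = M x

  menWorst-worst : ∀ M M' → MenWorstOf M M' (menWorst M M')
  menWorst-worst M M' x with mrank I x (M x) ≤? mrank I x (M' x)
  ... | yes M≤M' = inj₂ (refl , M≤M')
  ... | no M≰M' = inj₁ (refl , <⇒≤ (≰⇒> M≰M'))

  module MenWorst {M M' N} (stable : IsStable I M) (stable' : IsStable I M') (worst : MenWorstOf M M' N) where

    private
      worse-in-M-meets-worse-in-M' : ∀ {a b} → mrank I a (M' a) ≤ mrank I a (M a) → mrank I b (M b) ≤ mrank I b (M' b) →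
        M a ≡ M' b → a ≡ b
      worse-in-M-meets-worse-in-M' {a} {b} M'a≤Ma Mb≤M'b Ma≡M'b with M' a ≟ M a | M b ≟ M' b
      ... | yes M'a≡Ma | _ = proj₁ stable' (trans M'a≡Ma Ma≡M'b)
      ... | no _ | yes Mb≡M'b = proj₁ stable (trans Ma≡M'b (sym Mb≡M'b))
      ... | no M'a≢Ma | no Mb≢M'b = ⊥-elim (<-asym a-preferred b-preferred)
        where
        a-preferred : wrank I (M a) a < wrank I (M a) b
        a-preferred = men-gain⇒women-lose stable stable'
          (≤∧≢⇒< M'a≤Ma (M'a≢Ma ∘ mrank-injective a)) (sym Ma≡M'b)
        b-preferred : wrank I (M a) b < wrank I (M a) a
        b-preferred = subst (λ w → wrank I w b < wrank I w a) (sym Ma≡M'b)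
          (men-gain⇒women-lose stable' stable (≤∧≢⇒< Mb≤M'b (Mb≢M'b ∘ mrank-injective b)) Ma≡M'b)

    N-injective : IsMatching I N
    N-injective {a} {b} Na≡Nb with worst a | worst b
    ... | inj₁ (Na≡Ma , _) | inj₁ (Nb≡Mb , _) = proj₁ stable (trans (sym Na≡Ma) (trans Na≡Nb Nb≡Mb))
    ... | inj₂ (Na≡M'a , _) | inj₂ (Nb≡M'b , _) = proj₁ stable' (trans (sym Na≡M'a) (trans Na≡Nb Nb≡M'b))
    ... | inj₁ (Na≡Ma , a-worse) | inj₂ (Nb≡M'b , b-worse) =
      worse-in-M-meets-worse-in-M' a-worse b-worse (trans (sym Na≡Ma) (trans Na≡Nb Nb≡M'b))
    ... | inj₂ (Na≡M'a , a-worse) | inj₁ (Nb≡Mb , b-worse) =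
      sym (worse-in-M-meets-worse-in-M' b-worse a-worse (trans (sym Nb≡Mb) (trans (sym Na≡Nb) Na≡M'a)))

    M≤N : ∀ x → mrank I x (M x) ≤ mrank I x (N x)
    M≤N x with worst x
    ... | inj₁ (Nx≡Mx , _) = ≤-reflexive (cong (mrank I x) (sym Nx≡Mx))
    ... | inj₂ (Nx≡M'x , M≤M') = subst (λ w → mrank I x (M x) ≤ mrank I x w) (sym Nx≡M'x) M≤M'

    N-better-for-women : ∀ {w z x} → M z ≡ w → N x ≡ w → x ≡ z ⊎ wrank I w x < wrank I w z
    N-better-for-women {w} {z} {x} Mz≡w Nx≡w with worst x
    ... | inj₁ (Nx≡Mx , _) = inj₁ (proj₁ stable (trans (sym Nx≡Mx) (trans Nx≡w (sym Mz≡w))))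
    ... | inj₂ (Nx≡M'x , M≤M') with M x ≟ M' x
    ...   | yes Mx≡M'x = inj₁ (proj₁ stable (trans Mx≡M'x (trans (sym Nx≡M'x) (trans Nx≡w (sym Mz≡w)))))
    ...   | no Mx≢M'x = inj₂ (subst (λ v → wrank I v x < wrank I v z) (trans (sym Nx≡M'x) Nx≡w)
            (men-gain⇒women-lose stable' stable (≤∧≢⇒< M≤M' (Mx≢M'x ∘ mrank-injective x))
              (trans Mz≡w (sym (trans (sym Nx≡M'x) Nx≡w)))))

    PrefersToPartner-N⇒M : ∀ {w m} → PrefersToPartner I N w m → PrefersToPartner I M w m
    PrefersToPartner-N⇒M {w} w-prefers z Mz≡w with N-better-for-women Mz≡w (f∘preimage N-injective w)
    ... | inj₁ refl = w-prefers _ (f∘preimage N-injective w)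
    ... | inj₂ better = <-trans (w-prefers _ (f∘preimage N-injective w)) better

    unblocked-where-N≡M : ∀ {m w} → N m ≡ M m → ¬ (mrank I m w < mrank I m (N m) × PrefersToPartner I N w m)
    unblocked-where-N≡M {m} {w} Nm≡Mm (m-prefers , w-prefers) = proj₂ stable m w
      (subst (λ v → mrank I m w < mrank I m v) Nm≡Mm m-prefers , PrefersToPartner-N⇒M w-prefers)

  MenWorstOf-stable : ∀ {M M' N} → IsStable I M → IsStable I M' → MenWorstOf M M' N → IsStable I N
  MenWorstOf-stable {N = N} stable stable' worst = MenWorst.N-injective stable stable' worst , unblocked
    where
    unblocked : ∀ m w → ¬ (mrank I m w < mrank I m (N m) × PrefersToPartner I N w m)
    unblocked m w with worst m
    ... | inj₁ (Nm≡Mm , _) = MenWorst.unblocked-where-N≡M stable stable' worst Nm≡Mm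
    ... | inj₂ (Nm≡M'm , _) = MenWorst.unblocked-where-N≡M stable' stable (MenWorstOf-sym worst) Nm≡M'm

  module ExposedRotation {M M' N} (stable : IsStable I M) (stable' : IsStable I M') (worst : MenWorstOf M M' N)
    (ρ : List (Fin n × Fin n)) (M-ρ : All (λ p → M (proj₁ p) ≡ proj₂ p) ρ)
    (next-ρ : All (λ q → IsNext I M (proj₁ (proj₁ q)) (proj₂ (proj₂ q))) (cycPairs ρ)) where
    open MenWorst stable stable' worst

    -- If N moves m away from his partner in ρ, then N m comes after M m on m's list and prefers m to
    -- her M-partner, so by the definition of s_M it does not come before w₁ = s_M(m). It is not w₁,
    -- whose N-partner is m₁, and if it came after w₁ then (m , w₁) would block N.
    N-leaves-along-ρ : ∀ {p q} → (p , q) ∈ cycPairs ρ → N (proj₁ p) ≢ proj₂ p → N (proj₁ q) ≢ proj₂ q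
    N-leaves-along-ρ {m , w} {m₁ , w₁} link Nm≢w Nm₁≡w₁ = [ blocking , Nm-is-w₁ ] (m≤n⇒m<n∨m≡n w₁≤Nm)
      where
      Mm≡w : M m ≡ w
      Mm≡w = All.lookup M-ρ (proj₁ (cycPairs-members ρ link))
      Mm₁≡w₁ : M m₁ ≡ w₁
      Mm₁≡w₁ = All.lookup M-ρ (proj₂ (cycPairs-members ρ link))
      next : IsNext I M m w₁
      next = All.lookup next-ρ link
      Nm≢Mm : N m ≢ M m
      Nm≢Mm Nm≡Mm = Nm≢w (trans Nm≡Mm Mm≡w)
      m-worse : mrank I m (M m) < mrank I m (N m)
      m-worse = ≤∧≢⇒< (M≤N m) (λ eq → Nm≢Mm (sym (mrank-injective m eq)))
      Nm-prefers : PrefersToPartner I M (N m) m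
      Nm-prefers z Mz≡Nm with N-better-for-women Mz≡Nm refl
      ... | inj₁ refl = ⊥-elim (Nm≢Mm (sym Mz≡Nm))
      ... | inj₂ better = better
      w₁≤Nm : mrank I m w₁ ≤ mrank I m (N m)
      w₁≤Nm = ≮⇒≥ (λ before → proj₂ (proj₂ next) (N m) m-worse before Nm-prefers)
      blocking : ¬ (mrank I m w₁ < mrank I m (N m))
      blocking m-prefers = proj₂ (MenWorstOf-stable stable stable' worst) m w₁
        (m-prefers , prefersToPartner N-injective Nm₁≡w₁ (proj₁ (proj₂ next) m₁ Mm₁≡w₁))
      Nm-is-w₁ : mrank I m w₁ ≢ mrank I m (N m)
      Nm-is-w₁ eq = <-irrefl (cong (mrank I m) (trans (cong M (sym m₁≡m)) Mm₁≡w₁)) (proj₁ next)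
        where
        m₁≡m : m₁ ≡ m
        m₁≡m = N-injective (trans Nm₁≡w₁ (mrank-injective m eq))

    N-contains-ρ : ∀ {e} → e ∈ ρ → N (proj₁ e) ≡ proj₂ e → ∀ {p} → p ∈ ρ → N (proj₁ p) ≡ proj₂ p
    N-contains-ρ e∈ Ne {p} p∈ with N (proj₁ p) ≟ proj₂ p
    ... | yes Np = Np
    ... | no Np̸ = ⊥-elim (cycPairs-transport ρ (λ p → N (proj₁ p) ≢ proj₂ p) N-leaves-along-ρ p∈ e∈ Np̸ Ne)

    IsNext-in-N : (∀ {p} → p ∈ ρ → N (proj₁ p) ≡ proj₂ p) →
      ∀ {p q} → (p , q) ∈ cycPairs ρ → IsNext I N (proj₁ p) (proj₂ q)
    IsNext-in-N N⊇ρ {m , _} {m₁ , w₁} link =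
      subst (λ w → mrank I m w < mrank I m w₁) (sym Nm≡Mm) after ,
      prefersToPartner N-injective (N⊇ρ q∈) (w₁-prefers m₁ (All.lookup M-ρ q∈)) ,
      λ w' N-before before w'-prefers →
        nothing-between w' (subst (λ w → mrank I m w < mrank I m w') Nm≡Mm N-before) before
          (PrefersToPartner-N⇒M w'-prefers)
      where
      p∈ : (m , _) ∈ ρ
      p∈ = proj₁ (cycPairs-members ρ link)
      q∈ : (m₁ , w₁) ∈ ρ
      q∈ = proj₂ (cycPairs-members ρ link)
      after : mrank I m (M m) < mrank I m w₁
      after = proj₁ (All.lookup next-ρ link)
      w₁-prefers : PrefersToPartner I M w₁ m
      w₁-prefers = proj₁ (proj₂ (All.lookup next-ρ link))
      nothing-between : ∀ w' → mrank I m (M m) < mrank I m w' → mrank I m w' < mrank I m w₁ →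
        ¬ PrefersToPartner I M w' m
      nothing-between = proj₂ (proj₂ (All.lookup next-ρ link))
      Nm≡Mm : N m ≡ M m
      Nm≡Mm = trans (N⊇ρ p∈) (sym (All.lookup M-ρ p∈))

  IsNext-functional : ∀ {M m w w'} → IsNext I M m w → IsNext I M m w' → w ≡ w'
  IsNext-functional {m = m} {w} {w'} (after , prefers , nothing-between) (after' , prefers' , nothing-between')
    with <-cmp (mrank I m w) (mrank I m w')
  ... | tri< before _ _ = ⊥-elim (nothing-between' w after before prefers)
  ... | tri≈ _ eq _ = mrank-injective m eq
  ... | tri> _ _ before = ⊥-elim (nothing-between w' after' before prefers')

  RotationStep : (Fin n → Fin n) → Fin n × Fin n → Fin n × Fin n → Set
  RotationStep N p q = N (proj₁ p) ≡ proj₂ p × N (proj₁ q) ≡ proj₂ q × IsNext I N (proj₁ p) (proj₂ q)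

  RotationStep-functional : ∀ {N} → IsMatching I N → ∀ {p q q'} → RotationStep N p q → RotationStep N p q' → q ≡ q'
  RotationStep-functional N-inj (_ , Nq , next) (_ , Nq' , next')
    with refl ← IsNext-functional next next' with refl ← N-inj (trans Nq (sym Nq')) = refl

  rotations-sharing-pair : ∀ {ρ σ} → IsRotation I ρ → IsRotation I σ → ∀ {e} → e ∈ ρ → e ∈ σ → SamePairs ρ σ
  rotations-sharing-pair {ρ} {σ} (M , stable , _ , _ , M-ρ , next-ρ) (M' , stable' , _ , _ , M'-σ , next-σ) {e} e∈ρ e∈σ _ =
    cycles-of-functional-relation (RotationStep N) (RotationStep-functional N-inj) ρ σ ρ-steps σ-steps e∈ρ e∈σ ,
    cycles-of-functional-relation (RotationStep N) (RotationStep-functional N-inj) σ ρ σ-steps ρ-steps e∈σ e∈ρ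
    where
    N : Fin n → Fin n
    N = menWorst M M'
    worst : MenWorstOf M M' N
    worst = menWorst-worst M M'
    N-inj : IsMatching I N
    N-inj = proj₁ (MenWorstOf-stable stable stable' worst)
    module Mρ = ExposedRotation stable stable' worst ρ M-ρ next-ρ
    module M'σ = ExposedRotation stable' stable (MenWorstOf-sym worst) σ M'-σ next-σ
    N-contains-e : N (proj₁ e) ≡ proj₂ e
    N-contains-e with worst (proj₁ e)
    ... | inj₁ (NM , _) = trans NM (All.lookup M-ρ e∈ρ)
    ... | inj₂ (NM' , _) = trans NM' (All.lookup M'-σ e∈σ)
    ρ-steps : ∀ {p q} → (p , q) ∈ cycPairs ρ → RotationStep N p q
    ρ-steps link = let N⊇ρ = Mρ.N-contains-ρ e∈ρ N-contains-e ; (p∈ , q∈) = cycPairs-members ρ link in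
      N⊇ρ p∈ , N⊇ρ q∈ , Mρ.IsNext-in-N N⊇ρ link
    σ-steps : ∀ {p q} → (p , q) ∈ cycPairs σ → RotationStep N p q
    σ-steps link = let N⊇σ = M'σ.N-contains-ρ e∈σ N-contains-e ; (p∈ , q∈) = cycPairs-members σ link in
      N⊇σ p∈ , N⊇σ q∈ , M'σ.IsNext-in-N N⊇σ link

-- Ranks in an instance of range at most k

minF≤ : ∀ {n} (f : Fin n → ℕ) j → minF f ≤ f j
minF≤ {suc zero} f fzero = ≤-refl
minF≤ {suc (suc n)} f fzero = m⊓n≤m _ _
minF≤ {suc (suc n)} f (fsuc j) = ≤-trans (m⊓n≤n _ _) (minF≤ (f ∘ fsuc) j)

≤maxF : ∀ {n} (f : Fin n → ℕ) j → f j ≤ maxF f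
≤maxF {suc n} f fzero = m≤m⊔n _ _
≤maxF {suc n} f (fsuc j) = ≤-trans (≤maxF (f ∘ fsuc) j) (m≤n⊔m _ _)

≤max∧spread≤⇒<min+ : ∀ {x min max k} → x ≤ max → max ∸ min + 1 ≤ k → x < min + k
≤max∧spread≤⇒<min+ {x} {min} {max} {k} x≤max spread≤k = begin-strict
  x                    ≤⟨ x≤max ⟩
  max                  ≤⟨ m≤n+m∸n max min ⟩
  min + (max ∸ min)    <⟨ +-monoʳ-< min (m<m+n (max ∸ min) z<s) ⟩
  min + (max ∸ min + 1) ≤⟨ +-monoʳ-≤ min spread≤k ⟩
  min + k              ∎
  where open ≤-Reasoning

+k+k≡+2*k : ∀ x k → x + k + k ≡ x + 2 * k
+k+k≡+2*k x k = trans (+-assoc x k k) (cong (λ y → x + (k + y)) (sym (+-identityʳ k)))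

module _ {n : ℕ} (I : Instance n) {k : ℕ} (range≤k : range I ≤ k) where

  minrankM≤wrank : ∀ w m → minrankM I m ≤ wrank I w m
  minrankM≤wrank w m = minF≤ (λ w → wrank I w m) w

  minrankW≤mrank : ∀ m w → minrankW I w ≤ mrank I m w
  minrankW≤mrank m w = minF≤ (λ m → mrank I m w) m

  wrank<minrankM+k : ∀ w m → wrank I w m < minrankM I m + k
  wrank<minrankM+k w m = ≤max∧spread≤⇒<min+ (≤maxF (λ w → wrank I w m) w)
    (≤-trans (≤maxF (λ m → maxrankM I m ∸ minrankM I m + 1) m) (≤-trans (m≤m⊔n _ _) range≤k))

  mrank<minrankW+k : ∀ m w → mrank I m w < minrankW I w + k
  mrank<minrankW+k m w = ≤max∧spread≤⇒<min+ (≤maxF (λ m → mrank I m w) m)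
    (≤-trans (≤maxF (λ w → maxrankW I w ∸ minrankW I w + 1) w) (≤-trans (m≤n⊔m _ _) range≤k))

  module _ {M : Fin n → Fin n} (stable : IsStable I M) where
    open Instance I
    private
      M-inj : IsMatching I M
      M-inj = proj₁ stable

    -- The mrank m (M m) women that m ranks at least as high as M m have distinct partners, all of
    -- whom M m ranks below minrank m + 2k.
    mrank-partner≤minrankM+2k : ∀ m → mrank I m (M m) ≤ minrankM I m + 2 * k
    mrank-partner≤minrankM+2k m = prefix-count (mpos-inj m) (preimage-injective M-inj ∘ wpos-inj (M m)) (M m)
      (minrankM I m + 2 * k) λ y y-before → <⇒≤ (rank-of-y's-partner y (s≤s y-before))
      where
      rank-of-y's-partner : ∀ y → mrank I m y ≤ mrank I m (M m) →
        wrank I (M m) (preimage M-inj y) < minrankM I m + 2 * k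
      rank-of-y's-partner y y-before = begin-strict
        wrank I (M m) x        <⟨ wrank<minrankM+k (M m) x ⟩
        minrankM I x + k       ≤⟨ +-monoˡ-≤ k (minrankM≤wrank y x) ⟩
        wrank I y x + k        ≤⟨ +-monoˡ-≤ k (woman-weakly-prefers-partner I stable y-before (f∘preimage M-inj y)) ⟩
        wrank I y m + k        <⟨ +-monoˡ-< k (wrank<minrankM+k y m) ⟩
        minrankM I m + k + k   ≡⟨ +k+k≡+2*k (minrankM I m) k ⟩
        minrankM I m + 2 * k   ∎
        where
        open ≤-Reasoning
        x : Fin n
        x = preimage M-inj y

    -- Dually, the wrank (M m) m men that M m ranks at least as high as m have distinct partners, all
    -- of whom m ranks below minrank (M m) + 2k.
    minrankM≤minrankW-partner+2k : ∀ m → minrankM I m ≤ minrankW I (M m) + 2 * k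
    minrankM≤minrankW-partner+2k m = ≤-trans (minrankM≤wrank (M m) m)
      (prefix-count (wpos-inj (M m)) (M-inj ∘ mpos-inj m) m (minrankW I (M m) + 2 * k)
        λ y y-before → <⇒≤ (rank-of-y's-partner y (s≤s y-before)))
      where
      rank-of-y's-partner : ∀ y → wrank I (M m) y ≤ wrank I (M m) m →
        mrank I m (M y) < minrankW I (M m) + 2 * k
      rank-of-y's-partner y y-before = begin-strict
        mrank I m (M y)             <⟨ mrank<minrankW+k m (M y) ⟩
        minrankW I (M y) + k        ≤⟨ +-monoˡ-≤ k (minrankW≤mrank y (M y)) ⟩
        mrank I y (M y) + k         ≤⟨ +-monoˡ-≤ k (man-weakly-prefers-partner I stable refl y-before) ⟩
        mrank I y (M m) + k         <⟨ +-monoˡ-< k (mrank<minrankW+k y (M m)) ⟩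
        minrankW I (M m) + k + k    ≡⟨ +k+k≡+2*k (minrankW I (M m)) k ⟩
        minrankW I (M m) + 2 * k    ∎
        where open ≤-Reasoning

    minrankM<minrankM-next+k : ∀ {ρ} → All (λ p → M (proj₁ p) ≡ proj₂ p) ρ →
      All (λ q → IsNext I M (proj₁ (proj₁ q)) (proj₂ (proj₂ q))) (cycPairs ρ) →
      ∀ {p q} → (p , q) ∈ cycPairs ρ → minrankM I (proj₁ p) < minrankM I (proj₁ q) + k
    minrankM<minrankM-next+k {ρ} M-ρ next-ρ {m , _} {m' , w'} link = begin-strict
      minrankM I m       ≤⟨ minrankM≤wrank w' m ⟩
      wrank I w' m       <⟨ proj₁ (proj₂ (All.lookup next-ρ link)) m' (All.lookup M-ρ (proj₂ (cycPairs-members ρ link))) ⟩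
      wrank I w' m'      <⟨ wrank<minrankM+k w' m' ⟩
      minrankM I m' + k  ∎
      where open ≤-Reasoning

-- Representatives of the rotations whose extent contains i

listMin-∈ : ∀ x xs → listMin (x ∷ xs) ∈ x ∷ xs
listMin-∈ x [] = here refl
listMin-∈ x (y ∷ ys) with ⊓-sel y (foldr _⊓_ x ys)
... | inj₁ min≡y rewrite min≡y = there (here refl)
... | inj₂ min≡rest rewrite min≡rest with listMin-∈ x ys
...   | here eq = here eq
...   | there ∈ys = there (there ∈ys)

listMax-∈ : ∀ x xs → listMax (x ∷ xs) ∈ x ∷ xs
listMax-∈ x [] = here (⊔-identityʳ x)
listMax-∈ x (y ∷ ys) with ⊔-sel x (listMax (y ∷ ys))
... | inj₁ max≡x = here max≡x
... | inj₂ max≡rest rewrite max≡rest = there (listMax-∈ y ys)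

+2*k-trans : ∀ {x y} z k → x ≤ y + 2 * k → y ≤ z + 2 * k → x ≤ z + 4 * k
+2*k-trans {x} {y} z k x≤y+2k y≤z+2k = begin
  x                  ≤⟨ x≤y+2k ⟩
  y + 2 * k          ≤⟨ +-monoˡ-≤ (2 * k) y≤z+2k ⟩
  z + 2 * k + 2 * k  ≡⟨ collect z k ⟩
  z + 4 * k          ∎
  where
  open ≤-Reasoning
  collect : ∀ z k → z + 2 * k + 2 * k ≡ z + 4 * k
  collect = solve-∀

n≤n*n : ∀ n → n ≤ n * n
n≤n*n zero = z≤n
n≤n*n (suc n) = m≤m*n (suc n) (suc n)

codeSpace≤50k² : ∀ k → 9 * k * suc (4 * k) ≤ 50 * k * k
codeSpace≤50k² k = begin
  9 * k * suc (4 * k)          ≡⟨ expand k ⟩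
  36 * (k * k) + 9 * k         ≤⟨ +-monoʳ-≤ (36 * (k * k)) (*-monoʳ-≤ 9 k≤k*k) ⟩
  36 * (k * k) + 9 * (k * k)   ≤⟨ +-monoʳ-≤ (36 * (k * k)) (*-monoˡ-≤ (k * k) (m≤m+n 9 5)) ⟩
  36 * (k * k) + 14 * (k * k)  ≡⟨ collect k ⟩
  50 * k * k                   ∎
  where
  open ≤-Reasoning
  expand : ∀ k → 9 * k * suc (4 * k) ≡ 36 * (k * k) + 9 * k
  expand = solve-∀
  collect : ∀ k → 36 * (k * k) + 14 * (k * k) ≡ 50 * k * k
  collect = solve-∀
  k≤k*k : k ≤ k * k
  k≤k*k = n≤n*n k

module _ {n : ℕ} (I : Instance n) {k : ℕ} (range≤k : range I ≤ k) (i : ℕ) where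

  Near : Fin n → Set
  Near m = i ≤ minrankM I m + 4 * k × minrankM I m ≤ i + 4 * k

  PartnerWindow : Fin n × Fin n → Set
  PartnerWindow (m , w) = minrankM I m ≤ mrank I m w + 2 * k × mrank I m w ≤ minrankM I m + 2 * k

  Representative : List (Fin n × Fin n) → Set
  Representative ρ = ∃ λ p → p ∈ ρ × Near (proj₁ p) × PartnerWindow p

  InExt⇒bounds : ∀ {ρ} → InExt I k ρ i → rmin I ρ ≤ i + 2 * k × i ≤ rmax I ρ + 2 * k
  InExt⇒bounds {ρ} (lower , upper) =
    ≤-trans (m≤m+n (rmin I ρ) 1) (ℤ.drop‿+≤+
      (subst (ℤ._≤ + i ℤ.+ + (2 * k)) (shiftˡ (+ rmin I ρ) (+ (2 * k))) (ℤ.+-monoˡ-≤ (+ (2 * k)) lower))) ,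
    ≤-trans (m≤m+n i 1) (ℤ.drop‿+≤+
      (subst (+ i ℤ.+ + 1 ℤ.≤_) (shiftʳ (+ rmax I ρ) (+ (2 * k))) (ℤ.+-monoˡ-≤ (+ 1) upper)))
    where
    shiftˡ : ∀ x y → x ℤ.- y ℤ.+ + 1 ℤ.+ y ≡ x ℤ.+ + 1
    shiftˡ = ℤ.solve-∀
    shiftʳ : ∀ x y → x ℤ.+ y ℤ.- + 1 ℤ.+ + 1 ≡ x ℤ.+ y
    shiftʳ = ℤ.solve-∀

  agent-of : ∀ ρ {x} → x ∈ agentMinranks I ρ → ∃ λ p → p ∈ ρ × (x ≡ minrankM I (proj₁ p) ⊎ x ≡ minrankW I (proj₂ p))
  agent-of (p ∷ ρ) (here refl) = p , here refl , inj₁ refl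
  agent-of (p ∷ ρ) (there (here refl)) = p , here refl , inj₂ refl
  agent-of (p ∷ ρ) (there (there x∈)) with q , q∈ , agent ← agent-of ρ x∈ = q , there q∈ , agent

  module _ {M : Fin n → Fin n} (stable : IsStable I M) {ρ : List (Fin n × Fin n)}
    (M-ρ : All (λ p → M (proj₁ p) ≡ proj₂ p) ρ)
    (next-ρ : All (λ q → IsNext I M (proj₁ (proj₁ q)) (proj₂ (proj₂ q))) (cycPairs ρ)) where

    private
      minrankM≤minrankW+2k : ∀ {p} → p ∈ ρ → minrankM I (proj₁ p) ≤ minrankW I (proj₂ p) + 2 * k
      minrankM≤minrankW+2k {m , _} p∈ rewrite sym (All.lookup M-ρ p∈) =
        minrankM≤minrankW-partner+2k I range≤k stable m

      mrank≤minrankM+2k : ∀ {p} → p ∈ ρ → mrank I (proj₁ p) (proj₂ p) ≤ minrankM I (proj₁ p) + 2 * k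
      mrank≤minrankM+2k {m , _} p∈ rewrite sym (All.lookup M-ρ p∈) =
        mrank-partner≤minrankM+2k I range≤k stable m

      2*k≤4*k : 2 * k ≤ 4 * k
      2*k≤4*k = *-monoˡ-≤ k (m≤m+n 2 2)

    partner-window : ∀ {p} → p ∈ ρ → PartnerWindow p
    partner-window {m , w} p∈ =
      ≤-trans (minrankM≤minrankW+2k p∈) (+-monoˡ-≤ (2 * k) (minrankW≤mrank I range≤k m w)) ,
      mrank≤minrankM+2k p∈

    low-man : ∀ {x} → x ∈ agentMinranks I ρ → x ≤ i + 2 * k → ∃ λ p → p ∈ ρ × minrankM I (proj₁ p) ≤ i + 4 * k
    low-man x∈ x≤ with agent-of ρ x∈
    ... | p , p∈ , inj₁ refl = p , p∈ , ≤-trans x≤ (+-monoʳ-≤ i 2*k≤4*k)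
    ... | p , p∈ , inj₂ refl = p , p∈ , +2*k-trans i k (minrankM≤minrankW+2k p∈) x≤

    high-man : ∀ {x} → x ∈ agentMinranks I ρ → i ≤ x + 2 * k → ∃ λ p → p ∈ ρ × i ≤ minrankM I (proj₁ p) + 4 * k
    high-man {x} x∈ ≤x with agent-of ρ x∈
    ... | p , p∈ , inj₁ refl = p , p∈ , ≤-trans ≤x (+-monoʳ-≤ x 2*k≤4*k)
    ... | (m , w) , p∈ , inj₂ refl = (m , w) , p∈ ,
            +2*k-trans (minrankM I m) k ≤x (≤-trans (minrankW≤mrank I range≤k m w) (mrank≤minrankM+2k p∈))

    -- Along ρ the minranks of the men drop by less than k per step, so going from ph to pl they cannot
    -- pass from above the window [i − 4k , i + 4k] to below it without entering it.
    near-man : ∀ {pl ph} → pl ∈ ρ → minrankM I (proj₁ pl) ≤ i + 4 * k → ph ∈ ρ → i ≤ minrankM I (proj₁ ph) + 4 * k →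
      ∃ λ p → p ∈ ρ × Near (proj₁ p)
    near-man pl∈ low ph∈ high with Any.any? (λ p → (i ≤? minrankM I (proj₁ p) + 4 * k) ×-dec (minrankM I (proj₁ p) ≤? i + 4 * k)) ρ
    ... | yes found = find found
    ... | no none = ⊥-elim (<⇒≱ (cycPairs-transport ρ FarAbove step ph∈ pl∈ (far-above ph∈ high)) low)
      where
      FarAbove : Fin n × Fin n → Set
      FarAbove p = i + 4 * k < minrankM I (proj₁ p)
      far-above : ∀ {p} → p ∈ ρ → i ≤ minrankM I (proj₁ p) + 4 * k → FarAbove p
      far-above p∈ high = ≰⇒> λ low → none (lose p∈ (high , low))
      step : ∀ {p q} → (p , q) ∈ cycPairs ρ → FarAbove p → FarAbove q
      step {p} {q} link far = far-above (proj₂ (cycPairs-members ρ link)) (begin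
        i                          ≤⟨ m≤m+n i (4 * k) ⟩
        i + 4 * k                  ≤⟨ <⇒≤ (<-trans far (minrankM<minrankM-next+k I range≤k stable M-ρ next-ρ link)) ⟩
        minrankM I (proj₁ q) + k   ≤⟨ +-monoʳ-≤ (minrankM I (proj₁ q)) (m≤n*m k 4) ⟩
        minrankM I (proj₁ q) + 4 * k ∎)
        where open ≤-Reasoning

  representative : ∀ {ρ} → IsRotation I ρ → InExt I k ρ i → Representative ρ
  representative {[]} (_ , _ , ρ≢[] , _) _ = ⊥-elim (ρ≢[] refl)
  representative {p ∷ ρ} (_ , stable , _ , _ , M-ρ , next-ρ) in-ext
    with _ , pl∈ , low ← low-man stable M-ρ next-ρ (listMin-∈ _ _) (proj₁ (InExt⇒bounds {p ∷ ρ} in-ext))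
       | _ , ph∈ , high ← high-man stable M-ρ next-ρ (listMax-∈ _ _) (proj₂ (InExt⇒bounds {p ∷ ρ} in-ext))
    with q , q∈ , near ← near-man stable M-ρ next-ρ pl∈ low ph∈ high
    = q , q∈ , near , partner-window stable M-ρ next-ρ q∈

  module _ (w₀ : Fin n) where

    private
      i≤wrank+4k : ∀ {m} → Near m → i ≤ wrank I w₀ m + 4 * k
      i≤wrank+4k {m} near = ≤-trans (proj₁ near) (+-monoˡ-≤ (4 * k) (minrankM≤wrank I range≤k w₀ m))

      wrank+4k<i+9k : ∀ {m} → Near m → wrank I w₀ m + 4 * k < i + 9 * k
      wrank+4k<i+9k {m} near = begin-strict
        wrank I w₀ m + 4 * k          <⟨ +-monoˡ-< (4 * k) (wrank<minrankM+k I range≤k w₀ m) ⟩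
        minrankM I m + k + 4 * k      ≤⟨ +-monoˡ-≤ (4 * k) (+-monoˡ-≤ k (proj₂ near)) ⟩
        i + 4 * k + k + 4 * k         ≡⟨ collect i k ⟩
        i + 9 * k                     ∎
        where
        open ≤-Reasoning
        collect : ∀ i k → i + 4 * k + k + 4 * k ≡ i + 9 * k
        collect = solve-∀

      mrank+2k<minrankM+1+4k : ∀ {p} → PartnerWindow p →
        mrank I (proj₁ p) (proj₂ p) + 2 * k < minrankM I (proj₁ p) + suc (4 * k)
      mrank+2k<minrankM+1+4k {m , w} window = subst (mrank I m w + 2 * k <_) (sym (+-suc (minrankM I m) (4 * k)))
        (s≤s (+2*k-trans (minrankM I m) k ≤-refl (proj₂ window)))

    manCode : ∀ {m} → Near m → Fin (9 * k)
    manCode near = offset (i≤wrank+4k near) (wrank+4k<i+9k near)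

    manCode-injective : ∀ {m m'} (near : Near m) (near' : Near m') → manCode near ≡ manCode near' → m ≡ m'
    manCode-injective near near' eq = wrank-injective I w₀ (+-cancelʳ-≡ (4 * k) _ _
      (offset-injective (i≤wrank+4k near) (wrank+4k<i+9k near) (i≤wrank+4k near') (wrank+4k<i+9k near') eq))

    partnerCode : ∀ {p} → PartnerWindow p → Fin (suc (4 * k))
    partnerCode window = offset (proj₁ window) (mrank+2k<minrankM+1+4k window)

    partnerCode-injective : ∀ {m m' w w'} → m ≡ m' → (window : PartnerWindow (m , w)) (window' : PartnerWindow (m' , w')) →
      partnerCode window ≡ partnerCode window' → w ≡ w'
    partnerCode-injective {m} refl window window' eq = mrank-injective I m (+-cancelʳ-≡ (2 * k) _ _
      (offset-injective (proj₁ window) (mrank+2k<minrankM+1+4k window)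
                        (proj₁ window') (mrank+2k<minrankM+1+4k window') eq))

    -- wrank w₀ m identifies m, and lies in a window of width 9k around i; the window is shifted
    -- by 4k so that its lower end i needs no truncated subtraction.
    code : ∀ {ρ} → Representative ρ → Fin (9 * k * suc (4 * k))
    code ((m , w) , _ , near , window) = combine (manCode near) (partnerCode window)

    code-injective : ∀ {ρ σ} (r : Representative ρ) (s : Representative σ) → code r ≡ code s → proj₁ r ≡ proj₁ s
    code-injective ((m , w) , _ , near , window) ((m' , w') , _ , near' , window') eq =
      cong₂ _,_ m≡m' (partnerCode-injective m≡m' window window'
        (combine-injectiveʳ (manCode near) (partnerCode window) (manCode near') (partnerCode window') eq))
      where
      m≡m' : m ≡ m'
      m≡m' = manCode-injective near near'
        (combine-injectiveˡ (manCode near) (partnerCode window) (manCode near') (partnerCode window') eq)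

lemma7p8 : (n k : ℕ) (I : Instance n) → range I ≤ k →
    (i : ℕ) → 1 ≤ i → i ≤ n →
    (rs : List (List (Fin n × Fin n))) →
    All (IsRotation I) rs →
    All (λ ρ → InExt I k ρ i) rs →
    AllPairs (λ ρ σ → ¬ SamePairs ρ σ) rs →
    length rs ≤ 50 * k * k
lemma7p8 zero k I range≤k i 1≤i i≤0 rs rotations in-ext distinct with () ← ≤-trans 1≤i i≤0
lemma7p8 (suc n) k I range≤k i _ _ rs rotations in-ext distinct = begin
  length rs            ≤⟨ length≤-by-separating-code codeOf separates represented distinct ⟩
  9 * k * suc (4 * k)  ≤⟨ codeSpace≤50k² k ⟩
  50 * k * k           ∎
  where
  open ≤-Reasoning
  Represented : List (Fin (suc n) × Fin (suc n)) → Set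
  Represented ρ = IsRotation I ρ × Representative I range≤k i ρ
  represented : All Represented rs
  represented = All.zipWith (λ (rotation , ext) → rotation , representative I range≤k i rotation ext) (rotations , in-ext)
  codeOf : ∀ {ρ} → Represented ρ → Fin (9 * k * suc (4 * k))
  codeOf (_ , r) = code I range≤k i fzero r
  separates : ∀ {ρ σ} (r : Represented ρ) (s : Represented σ) → ¬ SamePairs ρ σ → codeOf r ≢ codeOf s
  separates (rotation , r) (rotation' , s) different same-code = different
    (rotations-sharing-pair I rotation rotation' (proj₁ (proj₂ r))
      (subst (_∈ _) (sym (code-injective I range≤k i fzero r s same-code)) (proj₁ (proj₂ s))))
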